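{- In the monotonicity construction described in the context, let $\mathcal A$ be any non-adaptive deterministic algorithm with (fixed) query set $Q\subseteq\{0,1\}^n$, and let $\mathsf{Bad}$ be the event (depending on $Q$ and the random $(\mathbf A,\mathbf T)$) defined in the context. Then the distribution of the tuple of answers $(\mathbf f(x))_{x\in Q}$ for $\mathbf f\sim\mathcal D_{\mathrm{yes}}$ conditioned on $\overline{\mathsf{Bad}}$ equals the distribution of $(\mathbf f(x))_{x\in Q}$ for $\mathbf f\sim\mathcal D_{\mathrm{no}}$ conditioned on $\overline{\mathsf{Bad}}$.
   Context: Let $c_0$ be a sufficiently large and $c_1>0$ a sufficiently small absolute constant; $\varepsilon\in(0,1)$ with $\varepsilon\ge c_0/\sqrt n$, $a=\sqrt n/\varepsilon$, $m=n-a$, $L=0.1\cdot2^{\sqrt m/\varepsilon}$. For $y\in\{0,1\}^a$ ($|y|$ = Hamming weight): $h^{(+,0)}\equiv0$; $h^{(+,1)}(y)=1$ iff $|y|>a/2+c_1\sqrt a$ or $|y|<a/2-c_1\sqrt a$; $h^{(-,0)}(y)=1$ iff $|y|>a/2+c_1\sqrt a$; $h^{(-,1)}(y)=1$ iff $|y|<a/2-c_1\sqrt a$. Draw $\mathbf A\subseteq[n]$ uniform of size $a$, $\mathbf C=[n]\setminus\mathbf A$, $\mathbf T=(\mathbf T_1,\dots,\mathbf T_L)$ with each $\mathbf T_i\subseteq\mathbf C$ independently the set of $\sqrt m/\varepsilon$ elements of $\mathbf C$ drawn independently uniformly with replacement, and $\mathbf b\in\{0,1\}^L$ uniform. For $z\in\{0,1\}^{\mathbf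 C}$: $T_i(z)=1$ iff $z_j=1$ for all $j\in T_i$; $S_T(z)=\{\ell:T_\ell(z)=1\}$; $x_B$ is the restriction of $x$ to $B$. $\mathcal D_{\mathrm{yes}}$: applying the first case that holds, $\mathbf f(x)=1$ if $|S_{\mathbf T}(x_{\mathbf C})|>1$ or $|x_{\mathbf C}|>m/2+0.05\varepsilon\sqrt m$; $\mathbf f(x)=0$ if $|S_{\mathbf T}(x_{\mathbf C})|=0$ or $|x_{\mathbf C}|<m/2$; otherwise $S_{\mathbf T}(x_{\mathbf C})=\{\ell\}$ and $\mathbf f(x)=h^{(+,\mathbf b_\ell)}(x_{\mathbf A})$. $\mathcal D_{\mathrm{no}}$: the same with $h^{(-,\mathbf b_\ell)}$ in place of $h^{(+,\mathbf b_\ell)}$ (both use the same distribution of $(\mathbf A,\mathbf T,\mathbf b)$). $\mathsf{Bad}$ is the event that there exist $x,y\in Q$ and $\ell\in[L]$ with $S_{\mathbf T}(x_{\mathbf C})=S_{\mathbf T}(y_{\mathbf C})=\{\ell\}$, $|x_{\mathbf C}|,|y_{\mathbf C}|\in[m/2,m/2+0.05\varepsilon\sqrt m]$, $|x_{\mathbf A}|>a/2+c_1\sqrt a$ and $|y_{\mathbf A}|<a/2-c_1\sqrt a$. -}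

module Defs where

open import Data.Bool using (Bool; true; false; _∧_; _∨_; not; if_then_else_)
open import Data.Nat using (ℕ; zero; suc; _+_; _*_; _<ᵇ_; _≡ᵇ_)
open import Data.Fin using (Fin; zero; suc; toℕ)
open import Data.List using (List; []; _∷_; map; concatMap; filterᵇ; allFin; length)
open import Data.Bool.ListAction using (any)
open import Data.Product using (_×_; _,_)

allFun : {B : Set} → List B → (k : ℕ) → List (Fin k → B)
allFun xs zero    = (λ ()) ∷ []
allFun xs (suc k) =
  concatMap (λ b → map (λ f → λ { zero → b ; (suc i) → f i }) (allFun xs k)) xs

bools : List Bool
bools = true ∷ false ∷ []

countᵇ : {X : Set} → (X → Bool) → List X → ℕ
countᵇ p xs = length (filterᵇ p xs)

weight : {k : ℕ} → (Fin k → Bool) → ℕ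
weight {zero}  x = 0
weight {suc k} x = (if x zero then 1 else 0) + weight (λ i → x (suc i))

weightOn : {k : ℕ} → (Fin k → Bool) → (Fin k → Bool) → ℕ
weightOn B x = weight (λ i → B i ∧ x i)

listEqᵇ : List Bool → List Bool → Bool
listEqᵇ []       []       = true
listEqᵇ (u ∷ us) (v ∷ vs) = (if u then v else not v) ∧ listEqᵇ us vs
listEqᵇ _        _        = false

-- Parameters: a = |A|, m = |C| = n - a (so n = a + m), t = size parameter
-- √m/ε of each T_i, L = number of T_i's.  The real-valued thresholds enter
-- only through comparisons with integer Hamming weights, so they are given
-- by natural numbers:
--   θhi = ⌊a/2 + c₁√a⌋   (|y| > a/2 + c₁√a  ⇔  |y| > θhi)
--   θlo = max(0, ⌈a/2 - c₁√a⌉)   (|y| < a/2 - c₁√a  ⇔  |y| < θlo)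
--   μhi = ⌊m/2 + 0.05 ε √m⌋   (|z| ≤ m/2 + 0.05ε√m  ⇔  |z| ≤ μhi)
--   |z| < m/2  ⇔  2|z| < m.

record Params : Set where
  field
    a m t L θhi θlo μhi : ℕ

module Construction (P : Params) where
  open Params P

  n : ℕ
  n = a + m

  Point : Set
  Point = Fin n → Bool

  SetA : Set
  SetA = Fin n → Bool

  -- T = (T_1,…,T_L); T ℓ j ∈ C is the j-th element drawn (with replacement) for T_ℓ
  Tuple : Set
  Tuple = Fin L → Fin t → Fin n

  Labels : Set
  Labels = Fin L → Bool

  hi lo : ℕ → Bool
  hi w = θhi <ᵇ w
  lo w = w <ᵇ θlo

  hPlus hMinus : Bool → ℕ → Bool
  hPlus false w = false
  hPlus true  w = hi w ∨ lo w
  hMinus false w = hi w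
  hMinus true  w = lo w

  wA wC : SetA → Point → ℕ
  wA A x = weightOn A x
  wC A x = weightOn (λ i → not (A i)) x

  Tsat : Tuple → Point → Fin L → Bool
  Tsat T x ℓ = allᵇ t (λ j → x (T ℓ j))
    where
      allᵇ : (k : ℕ) → (Fin k → Bool) → Bool
      allᵇ zero    g = true
      allᵇ (suc k) g = g zero ∧ allᵇ k (λ i → g (suc i))

  S : Tuple → Point → List (Fin L)
  S T x = filterᵇ (Tsat T x) (allFin L)

  mid : SetA → Point → Bool
  mid A x = not (2 * wC A x <ᵇ m) ∧ not (μhi <ᵇ wC A x)

  fcase : (Bool → ℕ → Bool) → SetA → Labels → Point → List (Fin L) → Bool
  fcase h A b x (_ ∷ _ ∷ _) = true
  fcase h A b x []          = μhi <ᵇ wC A x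
  fcase h A b x (ℓ ∷ [])    =
    if μhi <ᵇ wC A x then true
    else if 2 * wC A x <ᵇ m then false
    else h (b ℓ) (wA A x)

  f : (Bool → ℕ → Bool) → SetA → Tuple → Labels → Point → Bool
  f h A T b x = fcase h A b x (S T x)

  fYes fNo : SetA → Tuple → Labels → Point → Bool
  fYes = f hPlus
  fNo  = f hMinus

  isSingleton : List (Fin L) → Fin L → Bool
  isSingleton (k ∷ []) ℓ = toℕ k ≡ᵇ toℕ ℓ
  isSingleton _        ℓ = false

  Bad : List Point → SetA → Tuple → Bool
  Bad Q A T =
    any (λ x → any (λ y → any (λ ℓ →
        isSingleton (S T x) ℓ ∧ isSingleton (S T y) ℓ ∧ mid A x ∧ mid A y
        ∧ hi (wA A x) ∧ lo (wA A y)) (allFin L)) Q) Q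

  -- sample space: all (A, T, b) with |A| = a, every entry of T in C = [n] ∖ A,
  -- b ∈ {0,1}^L; the joint law of (A,T,b) is uniform on this list
  -- (each A has the same number m^{tL} · 2^L of completions).
  Omega : List (SetA × Tuple × Labels)
  Omega =
    concatMap (λ A →
      concatMap (λ T → map (λ b → A , T , b) (allFun bools L))
        (allFun (allFun (filterᵇ (λ i → not (A i)) (allFin n)) t) L))
      (filterᵇ (λ A → weight A ≡ᵇ a) (allFun bools n))

  -- number of sample points in ¬Bad on which the answers on Q equal v;
  -- conditional probability = this count / (size of ¬Bad), same denominator for yes/no
  countYes countNo : List Point → List Bool → ℕ
  countYes Q v = countᵇ (λ { (A , T , b) →
      not (Bad Q A T) ∧ listEqᵇ (map (fYes A T b) Q) v }) Omega
  countNo Q v = countᵇ (λ { (A , T , b) →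
      not (Bad Q A T) ∧ listEqᵇ (map (fNo A T b) Q) v }) Omega

{-# OPTIONS --safe #-}
-- Fix (A, T) outside Bad and let c ∈ {0,1}^L mark the indices ℓ for which some query x with
-- S_T(x_C) = {ℓ} and |x_C| in the middle range has a high A-weight.  Outside Bad no query in such
-- a slice has a low A-weight, and then h^{(+,b)} agrees with h^{(-,b ⊕ c_ℓ)} on every query of the
-- slice, so f_yes with labels b and f_no with labels b ⊕ c give the same answers on Q.  As b ↦ b ⊕ c
-- is a bijection of {0,1}^L, the answer vectors have the same count in every fibre over (A, T).
module Submission where

open import Defs
open import Data.Bool using (Bool; true; false; not; _∧_; _xor_; T)
open import Data.Bool.Properties using (T?; T-∧; ∨-identityʳ)
open import Data.Bool.ListAction using (any)
open import Data.Empty using (⊥-elim)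
open import Data.Nat using (ℕ; zero; suc; _+_; _*_; _<ᵇ_; _≡ᵇ_)
open import Data.Nat.Properties using (+-comm; ≡⇒≡ᵇ)
open import Data.Fin using (Fin; zero; suc; toℕ)
open import Data.List using (List; []; _∷_; map; concatMap; filterᵇ; _++_; length; allFin)
open import Data.List.Properties
  using (filter-++; filter-≐; length-++; ++-identityʳ; map-cong; map-cong-local)
open import Data.List.Membership.Propositional using (_∈_; lose; find)
open import Data.List.Membership.Propositional.Properties using (∈-allFin)
open import Data.List.Relation.Unary.All as All using ()
open import Data.List.Relation.Unary.Any.Properties using (any⁺; any⁻)
open import Data.Product as Product using (_×_; _,_)
open import Function using (_∘_)
open import Function.Bundles using (Equivalence)
open import Relation.Nullary using (¬_)
open import Relation.Binary.PropositionalEquality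

count-++ : {X : Set} (p : X → Bool) (xs ys : List X) →
  countᵇ p (xs ++ ys) ≡ countᵇ p xs + countᵇ p ys
count-++ p xs ys = trans (cong length (filter-++ (T? ∘ p) xs ys)) (length-++ (filterᵇ p xs))

count-cong : {X : Set} {p q : X → Bool} → (∀ x → p x ≡ q x) → (xs : List X) →
  countᵇ p xs ≡ countᵇ q xs
count-cong {p = p} {q} p≗q =
  cong length ∘ filter-≐ (T? ∘ p) (T? ∘ q)
    ((λ {x} → subst T (p≗q x)) , (λ {x} → subst T (sym (p≗q x))))

count-map : {X Y : Set} (p : Y → Bool) (g : X → Y) (xs : List X) →
  countᵇ p (map g xs) ≡ countᵇ (p ∘ g) xs
count-map p g []       = refl
count-map p g (x ∷ xs) with p (g x)
... | true  = cong suc (count-map p g xs)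
... | false = count-map p g xs

count-concatMap-cong : {X Y : Set} {p q : Y → Bool} (g : X → List Y) →
  (∀ x → countᵇ p (g x) ≡ countᵇ q (g x)) → (xs : List X) →
  countᵇ p (concatMap g xs) ≡ countᵇ q (concatMap g xs)
count-concatMap-cong         g eq []       = refl
count-concatMap-cong {p = p} {q} g eq (x ∷ xs) = begin
  countᵇ p (g x ++ concatMap g xs)             ≡⟨ count-++ p (g x) _ ⟩
  countᵇ p (g x) + countᵇ p (concatMap g xs)   ≡⟨ cong₂ _+_ (eq x) (count-concatMap-cong g eq xs) ⟩
  countᵇ q (g x) + countᵇ q (concatMap g xs)   ≡⟨ count-++ q (g x) _ ⟨
  countᵇ q (g x ++ concatMap g xs)             ∎
  where open ≡-Reasoning

Extensional : {k : ℕ} → ((Fin k → Bool) → Bool) → Set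
Extensional p = ∀ {b b'} → (∀ i → b i ≡ b' i) → p b ≡ p b'

infixr 5 _◂_
_◂_ : {k : ℕ} → Bool → (Fin k → Bool) → Fin (suc k) → Bool
(b ◂ f) zero    = b
(b ◂ f) (suc i) = f i

count-allFun-suc : ∀ k (p : (Fin (suc k) → Bool) → Bool) → Extensional p →
  countᵇ p (allFun bools (suc k))
    ≡ countᵇ (p ∘ (true ◂_)) (allFun bools k) + countᵇ (p ∘ (false ◂_)) (allFun bools k)
-- The two halves of allFun bools (suc k) are built by pattern lambdas of Defs, which cannot be
-- referred to by name: split abstracts over them and unification fills them in.
count-allFun-suc k p ext = split _ _ (λ { f zero → refl ; f (suc i) → refl })
                                     (λ { f zero → refl ; f (suc i) → refl })
  where
  fs = allFun bools k
  count-map-◂ : ∀ b g → (∀ f i → g f i ≡ (b ◂ f) i) → countᵇ p (map g fs) ≡ countᵇ (p ∘ (b ◂_)) fs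
  count-map-◂ b g g≗◂ = trans (count-map p g fs) (count-cong (λ f → ext (g≗◂ f)) fs)
  split : ∀ gt gf → (∀ f i → gt f i ≡ (true ◂ f) i) → (∀ f i → gf f i ≡ (false ◂ f) i) →
    countᵇ p (map gt fs ++ map gf fs ++ [])
      ≡ countᵇ (p ∘ (true ◂_)) fs + countᵇ (p ∘ (false ◂_)) fs
  split gt gf gt≗ gf≗ = begin
    countᵇ p (map gt fs ++ map gf fs ++ [])   ≡⟨ cong (λ ys → countᵇ p (map gt fs ++ ys)) (++-identityʳ _) ⟩
    countᵇ p (map gt fs ++ map gf fs)         ≡⟨ count-++ p (map gt fs) _ ⟩
    countᵇ p (map gt fs) + countᵇ p (map gf fs)
      ≡⟨ cong₂ _+_ (count-map-◂ true gt gt≗) (count-map-◂ false gf gf≗) ⟩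
    countᵇ (p ∘ (true ◂_)) fs + countᵇ (p ∘ (false ◂_)) fs ∎
    where open ≡-Reasoning

◂-cong : ∀ {k} b {f f' : Fin k → Bool} → (∀ i → f i ≡ f' i) → ∀ i → (b ◂ f) i ≡ (b ◂ f') i
◂-cong b f≗f' zero    = refl
◂-cong b f≗f' (suc i) = f≗f' i

infixr 6 _⊕_
_⊕_ : {k : ℕ} → (Fin k → Bool) → (Fin k → Bool) → Fin k → Bool
(c ⊕ b) i = c i xor b i

count-allFun-⊕ : ∀ k (c : Fin k → Bool) (p : (Fin k → Bool) → Bool) → Extensional p →
  countᵇ (p ∘ (c ⊕_)) (allFun bools k) ≡ countᵇ p (allFun bools k)
count-allFun-⊕ zero    c p ext = count-cong (λ b → ext (λ ())) (allFun bools zero)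
count-allFun-⊕ (suc k) c p ext = begin
  countᵇ (p ∘ (c ⊕_)) (allFun bools (suc k))
    ≡⟨ count-allFun-suc k (p ∘ (c ⊕_)) (λ b≗b' → ext (λ i → cong (c i xor_) (b≗b' i))) ⟩
  countᵇ (p ∘ (c ⊕_) ∘ (true ◂_)) fs + countᵇ (p ∘ (c ⊕_) ∘ (false ◂_)) fs
    ≡⟨ cong₂ _+_ (split-head true) (split-head false) ⟩
  countᵇ (p ∘ ((c zero xor true) ◂_)) fs + countᵇ (p ∘ ((c zero xor false) ◂_)) fs
    ≡⟨ swap-halves (c zero) ⟩
  countᵇ (p ∘ (true ◂_)) fs + countᵇ (p ∘ (false ◂_)) fs
    ≡⟨ count-allFun-suc k p ext ⟨
  countᵇ p (allFun bools (suc k)) ∎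
  where
  open ≡-Reasoning
  fs = allFun bools k
  ⊕-◂ : ∀ b f i → (c ⊕ (b ◂ f)) i ≡ ((c zero xor b) ◂ (c ∘ suc) ⊕ f) i
  ⊕-◂ b f zero    = refl
  ⊕-◂ b f (suc i) = refl
  split-head : ∀ b → countᵇ (p ∘ (c ⊕_) ∘ (b ◂_)) fs ≡ countᵇ (p ∘ ((c zero xor b) ◂_)) fs
  split-head b = trans (count-cong (λ f → ext (⊕-◂ b f)) fs)
    (count-allFun-⊕ k (c ∘ suc) (p ∘ ((c zero xor b) ◂_)) (λ f≗f' → ext (◂-cong _ f≗f')))
  swap-halves : ∀ c₀ →
    countᵇ (p ∘ ((c₀ xor true) ◂_)) fs + countᵇ (p ∘ ((c₀ xor false) ◂_)) fs
      ≡ countᵇ (p ∘ (true ◂_)) fs + countᵇ (p ∘ (false ◂_)) fs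
  swap-halves true  = +-comm (countᵇ (p ∘ (false ◂_)) fs) _
  swap-halves false = refl

∧-intro : ∀ {a b} → T a → T b → T (a ∧ b)
∧-intro ta tb = Equivalence.from T-∧ (ta , tb)

module _ (P : Params) where
  open Params P
  open Construction P

  hPlus≡hMinus-xor : ∀ b c w → (T (hi w) → T c) → (T (lo w) → ¬ T c) → hPlus b w ≡ hMinus (c xor b) w
  hPlus≡hMinus-xor true  true  w hi⇒c lo⇒¬c with lo w
  ... | true  = ⊥-elim (lo⇒¬c _ _)
  ... | false = ∨-identityʳ (hi w)
  hPlus≡hMinus-xor false true  w hi⇒c lo⇒¬c with lo w
  ... | true  = ⊥-elim (lo⇒¬c _ _)
  ... | false = refl
  hPlus≡hMinus-xor true  false w hi⇒c lo⇒¬c with hi w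
  ... | true  = ⊥-elim (hi⇒c _)
  ... | false = refl
  hPlus≡hMinus-xor false false w hi⇒c lo⇒¬c with hi w
  ... | true  = ⊥-elim (hi⇒c _)
  ... | false = refl

  fcase-cong : ∀ h h' A b b' x s →
    (∀ ℓ → T (isSingleton s ℓ) → T (mid A x) → h (b ℓ) (wA A x) ≡ h' (b' ℓ) (wA A x)) →
    fcase h A b x s ≡ fcase h' A b' x s
  fcase-cong h h' A b b' x []          agree = refl
  fcase-cong h h' A b b' x (_ ∷ _ ∷ _) agree = refl
  fcase-cong h h' A b b' x (ℓ ∷ [])    agree with μhi <ᵇ wC A x
  ... | true  = refl
  ... | false with 2 * wC A x <ᵇ m
  ...   | true  = refl
  ...   | false = agree ℓ (≡⇒≡ᵇ (toℕ ℓ) _ refl) _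

  module _ (Q : List Point) (A : SetA) (𝐓 : Tuple) where

    highAt : Fin L → Point → Bool
    highAt ℓ y = isSingleton (S 𝐓 y) ℓ ∧ mid A y ∧ hi (wA A y)

    highLabels : Labels
    highLabels ℓ = any (highAt ℓ) Q

    highAt-split : ∀ {ℓ y} → T (highAt ℓ y) →
      T (isSingleton (S 𝐓 y) ℓ) × T (mid A y) × T (hi (wA A y))
    highAt-split {ℓ} {y} h =
      Product.map₂ (Equivalence.to (T-∧ {mid A y})) (Equivalence.to (T-∧ {isSingleton (S 𝐓 y) ℓ}) h)

    badAt : Point → Point → Fin L → Bool
    badAt x y ℓ =
      isSingleton (S 𝐓 x) ℓ ∧ isSingleton (S 𝐓 y) ℓ ∧ mid A x ∧ mid A y ∧ hi (wA A x) ∧ lo (wA A y)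

    bad-witness : ∀ {x y ℓ} → x ∈ Q → y ∈ Q → T (badAt x y ℓ) → T (Bad Q A 𝐓)
    bad-witness {x} {y} x∈Q y∈Q xyℓ-bad =
      any⁺ _ (lose x∈Q (any⁺ _ (lose y∈Q (any⁺ (badAt x y) (lose (∈-allFin _) xyℓ-bad)))))

    module _ {ℓ : Fin L} {x : Point} (x∈Q : x ∈ Q)
             (x-single : T (isSingleton (S 𝐓 x) ℓ)) (x-mid : T (mid A x)) where

      high⇒highLabel : T (hi (wA A x)) → T (highLabels ℓ)
      high⇒highLabel x-hi = any⁺ _ (lose x∈Q (∧-intro x-single (∧-intro x-mid x-hi)))

      low⇒¬highLabel : ¬ T (Bad Q A 𝐓) → T (lo (wA A x)) → ¬ T (highLabels ℓ)
      low⇒¬highLabel ¬bad x-lo ℓ-high =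
        let y , y∈Q , y-high = find (any⁻ (highAt ℓ) Q ℓ-high)
            y-single , y-mid , y-hi = highAt-split y-high
        in ¬bad (bad-witness y∈Q x∈Q
             (∧-intro y-single (∧-intro x-single (∧-intro y-mid (∧-intro x-mid (∧-intro y-hi x-lo))))))

    fYes≡fNo-⊕highLabels : ¬ T (Bad Q A 𝐓) → ∀ b {x} → x ∈ Q →
      fYes A 𝐓 b x ≡ fNo A 𝐓 (highLabels ⊕ b) x
    fYes≡fNo-⊕highLabels ¬bad b {x} x∈Q = fcase-cong hPlus hMinus A b (highLabels ⊕ b) x (S 𝐓 x)
      λ ℓ x-single x-mid → hPlus≡hMinus-xor (b ℓ) (highLabels ℓ) (wA A x)
        (high⇒highLabel x∈Q x-single x-mid) (low⇒¬highLabel x∈Q x-single x-mid ¬bad)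

    module _ (v : List Bool) where

      answers : (Bool → ℕ → Bool) → Labels → Bool
      answers h b = listEqᵇ (map (f h A 𝐓 b) Q) v

      answers-hMinus-extensional : Extensional (answers hMinus)
      answers-hMinus-extensional b≗b' = cong (λ ys → listEqᵇ ys v) (map-cong (λ x →
        fcase-cong hMinus hMinus A _ _ x (S 𝐓 x) (λ ℓ _ _ → cong (λ c → hMinus c (wA A x)) (b≗b' ℓ))) Q)

      fibre-count-yes≡no : countᵇ (λ b → not (Bad Q A 𝐓) ∧ answers hPlus b) (allFun bools L)
                         ≡ countᵇ (λ b → not (Bad Q A 𝐓) ∧ answers hMinus b) (allFun bools L)
      fibre-count-yes≡no with Bad Q A 𝐓 in bad
      ... | true  = refl
      ... | false = begin
        countᵇ (answers hPlus) (allFun bools L)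
          ≡⟨ count-cong (λ b → cong (λ ys → listEqᵇ ys v)
               (map-cong-local (All.tabulate (fYes≡fNo-⊕highLabels ¬bad b)))) (allFun bools L) ⟩
        countᵇ (answers hMinus ∘ (highLabels ⊕_)) (allFun bools L)
          ≡⟨ count-allFun-⊕ L highLabels (answers hMinus) answers-hMinus-extensional ⟩
        countᵇ (answers hMinus) (allFun bools L) ∎
        where
        open ≡-Reasoning
        ¬bad : ¬ T (Bad Q A 𝐓)
        ¬bad = subst T bad

lemma4p6 : (P : Params) → (Q : List (Construction.Point P)) → (v : List Bool) →
    Construction.countYes P Q v ≡ Construction.countNo P Q v
lemma4p6 P Q v =
  count-concatMap-cong (λ A → concatMap (withLabels A) (tuplesAvoiding A)) (λ A →
    count-concatMap-cong (withLabels A) (λ 𝐓 → begin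
      countᵇ _ (withLabels A 𝐓)           ≡⟨ count-map _ (λ b → A , 𝐓 , b) (allFun bools L) ⟩
      countᵇ _ (allFun bools L)           ≡⟨ fibre-count-yes≡no P Q A 𝐓 v ⟩
      countᵇ _ (allFun bools L)           ≡⟨ count-map _ (λ b → A , 𝐓 , b) (allFun bools L) ⟨
      countᵇ _ (withLabels A 𝐓)           ∎) (tuplesAvoiding A))
    (filterᵇ (λ A → weight A ≡ᵇ a) (allFun bools n))
  where
  open ≡-Reasoning
  open Params P
  open Construction P
  tuplesAvoiding : SetA → List Tuple
  tuplesAvoiding A = allFun (allFun (filterᵇ (λ i → not (A i)) (allFin n)) t) L
  withLabels : SetA → Tuple → List (SetA × Tuple × Labels)
  withLabels A 𝐓 = map (λ b → A , 𝐓 , b) (allFun bools L)
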